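{- Let $A,B$ be positive integers with $A_\infty B_1\le 9$. Then $(A,B)$ is a polynomial pair.
   Context: For a positive integer $A$ with decimal representation $A=\sum_{i=0}^{a} a_i 10^i$ (digits $a_i\in\{0,\dots,9\}$, $a_a\neq0$), let $P(A,x)=\sum_{i=0}^a a_i x^i$, let $A_\infty=\max_i a_i$ be its largest digit and $A_1=P(A,1)$ its digit sum. A pair $(A,B)$ of positive integers is a polynomial pair if $P(A,x)P(B,x)=P(A\times B,x)$. -}

module Defs where

open import Data.Nat using (ℕ; zero; suc; _+_; _*_; _/_; _%_)
open import Data.List using (List; []; _∷_; foldr)
open import Data.Nat.ListAction using (sum)
open import Relation.Binary.PropositionalEquality using (_≡_; refl)
open import Data.List using () renaming (map to lmap)
import Data.Nat as N

-- Decimal digits of n, least significant first (a_0, a_1, ..., a_a).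
-- Fuel-based recursion: n itself is enough fuel since n / 10 < n for n > 0.
digitsFuel : ℕ → ℕ → List ℕ
digitsFuel zero    n = []
digitsFuel (suc f) zero = []
digitsFuel (suc f) (suc n) = (suc n % 10) ∷ digitsFuel f (suc n / 10)

digits : ℕ → List ℕ
digits n = digitsFuel n n

-- Polynomials with ℕ coefficients as coefficient lists (constant term first).
-- coeff p i = coefficient of x^i (0 beyond the list).
coeff : List ℕ → ℕ → ℕ
coeff []       _       = 0
coeff (c ∷ cs) zero    = c
coeff (c ∷ cs) (suc i) = coeff cs i

scale : ℕ → List ℕ → List ℕ
scale c = lmap (c *_)

addP : List ℕ → List ℕ → List ℕ
addP []       q        = q
addP p        []       = p
addP (a ∷ p)  (b ∷ q)  = (a + b) ∷ addP p q

mulP : List ℕ → List ℕ → List ℕ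
mulP []       q = []
mulP (a ∷ p)  q = addP (scale a q) (0 ∷ mulP p q)

P : ℕ → List ℕ
P A = digits A

-- Largest digit A_∞ and digit sum A_1.
maxDigit : ℕ → ℕ
maxDigit A = foldr N._⊔_ 0 (digits A)

digitSum : ℕ → ℕ
digitSum A = sum (digits A)

PolynomialPair : ℕ → ℕ → Set
PolynomialPair A B = ∀ i → coeff (mulP (P A) (P B)) i ≡ coeff (P (A * B)) i

private
  test1 : digits 1203 ≡ 3 ∷ 0 ∷ 2 ∷ 1 ∷ []
  test1 = refl
  test2 : mulP (P 12) (P 13) ≡ 6 ∷ 5 ∷ 1 ∷ []
  test2 = refl
  test3 : maxDigit 1293 ≡ 9
  test3 = refl

-- Write ⟦ p ⟧ₓ for the value of a coefficient list p at x.  The proof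
-- combines three facts.
--   (1) Evaluation at any x is a semiring homomorphism from coefficient
--       lists to ℕ; in particular ⟦ P(A) P(B) ⟧₁₀ = A · B, since the digit
--       list of n evaluates to n at 10.
--   (2) Base-b representations are unique: a list whose coefficients are
--       all below b is determined by its value at b, its i-th coefficient
--       being the i-th base-b digit of that value.
--   (3) The k-th coefficient of p · q is at most m · (q₀ + … + q_k) when all
--       coefficients of p are at most m; hence every coefficient of
--       P(A) P(B) is at most A_∞ · B_1 ≤ 9.
-- By (3) the product P(A) P(B) has coefficients below 10, so by (1) and (2)
-- it has the same coefficients as the digit list of A · B.
module Submission where

open import Defs
open import Data.Nat using (ℕ; zero; suc; _+_; _*_; _/_; _%_; _≤_; _<_; _⊔_; z≤n; s≤s; NonZero)
open import Data.Nat.Properties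
open import Data.Nat.DivMod
open import Data.Nat.Divisibility using (n∣m*n)
open import Data.Nat.ListAction using (sum)
open import Data.Nat.ListAction.Properties using (sum-++)
open import Data.List using (List; []; _∷_; _++_; foldr; take; drop)
open import Data.List.Properties using (take++drop≡id)
open import Relation.Binary.PropositionalEquality
open import Data.Nat.Solver using (module +-*-Solver)
open +-*-Solver using (solve; _:+_; _:*_; _:=_)

eval : ℕ → List ℕ → ℕ
eval x []       = 0
eval x (c ∷ cs) = c + eval x cs * x

eval-addP : ∀ x p q → eval x (addP p q) ≡ eval x p + eval x q
eval-addP x []      q       = refl
eval-addP x (a ∷ p) []      = sym (+-identityʳ _)
eval-addP x (a ∷ p) (b ∷ q) = begin
  a + b + eval x (addP p q) * x        ≡⟨ cong (λ e → a + b + e * x) (eval-addP x p q) ⟩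
  a + b + (eval x p + eval x q) * x    ≡⟨ solve 5 (λ a b u v x → a :+ b :+ (u :+ v) :* x
                                                      := a :+ u :* x :+ (b :+ v :* x))
                                                refl a b (eval x p) (eval x q) x ⟩
  a + eval x p * x + (b + eval x q * x) ∎
  where open ≡-Reasoning

eval-scale : ∀ x a q → eval x (scale a q) ≡ a * eval x q
eval-scale x a []      = sym (*-zeroʳ a)
eval-scale x a (b ∷ q) = begin
  a * b + eval x (scale a q) * x   ≡⟨ cong (λ e → a * b + e * x) (eval-scale x a q) ⟩
  a * b + a * eval x q * x         ≡⟨ solve 4 (λ a b v x → a :* b :+ a :* v :* x := a :* (b :+ v :* x))
                                            refl a b (eval x q) x ⟩
  a * (b + eval x q * x)           ∎
  where open ≡-Reasoning

eval-mulP : ∀ x p q → eval x (mulP p q) ≡ eval x p * eval x q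
eval-mulP x []      q = refl
eval-mulP x (a ∷ p) q = begin
  eval x (addP (scale a q) (0 ∷ mulP p q))        ≡⟨ eval-addP x (scale a q) (0 ∷ mulP p q) ⟩
  eval x (scale a q) + eval x (mulP p q) * x      ≡⟨ cong₂ (λ s t → s + t * x) (eval-scale x a q) (eval-mulP x p q) ⟩
  a * eval x q + eval x p * eval x q * x          ≡⟨ solve 4 (λ a u v x → a :* v :+ u :* v :* x := (a :+ u :* x) :* v)
                                                           refl a (eval x p) (eval x q) x ⟩
  (a + eval x p * x) * eval x q                   ∎
  where open ≡-Reasoning

eval-digitsFuel : ∀ f n → n ≤ f → eval 10 (digitsFuel f n) ≡ n
eval-digitsFuel zero    zero    _         = refl
eval-digitsFuel (suc f) zero    _         = refl
eval-digitsFuel (suc f) (suc n) (s≤s n≤f) = begin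
  suc n % 10 + eval 10 (digitsFuel f (suc n / 10)) * 10 ≡⟨ cong (λ e → suc n % 10 + e * 10)
                                                             (eval-digitsFuel f (suc n / 10) quotient≤f) ⟩
  suc n % 10 + suc n / 10 * 10                          ≡⟨ m≡m%n+[m/n]*n (suc n) 10 ⟨
  suc n                                                 ∎
  where
  open ≡-Reasoning
  quotient≤f : suc n / 10 ≤ f
  quotient≤f = ≤-trans (<⇒≤pred (m/n<m (suc n) 10 (s≤s (s≤s z≤n)))) n≤f

eval-P : ∀ n → eval 10 (P n) ≡ n
eval-P n = eval-digitsFuel n n ≤-refl

DigitList : ℕ → List ℕ → Set
DigitList b p = ∀ i → coeff p i < b

digitAt : (b : ℕ) → .{{NonZero b}} → ℕ → ℕ → ℕ
digitAt b n zero    = n % b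
digitAt b n (suc i) = digitAt b (n / b) i

digitAt-zero : ∀ b .{{_ : NonZero b}} i → digitAt b 0 i ≡ 0
digitAt-zero b zero    = n≤0⇒n≡0 (m%n≤m 0 b)
digitAt-zero b (suc i) = trans (cong (λ n → digitAt b n i) (0/n≡0 b)) (digitAt-zero b i)

lastDigit : ∀ b .{{_ : NonZero b}} {c} e → c < b → (c + e * b) % b ≡ c
lastDigit b {c} e c<b = trans ([m+kn]%n≡m%n c e b) (m<n⇒m%n≡m c<b)

shiftDigit : ∀ b .{{_ : NonZero b}} {c} e → c < b → (c + e * b) / b ≡ e
shiftDigit b {c} e c<b = begin
  (c + e * b) / b    ≡⟨ +-distrib-/-∣ʳ c (n∣m*n e) ⟩
  c / b + e * b / b  ≡⟨ cong₂ _+_ (m<n⇒m/n≡0 c<b) (m*n/n≡m e b) ⟩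
  e                  ∎
  where open ≡-Reasoning

coeff-digitAt : ∀ b .{{_ : NonZero b}} p → DigitList b p → ∀ i → coeff p i ≡ digitAt b (eval b p) i
coeff-digitAt b []       _      i       = sym (digitAt-zero b i)
coeff-digitAt b (c ∷ cs) c∷cs-digits zero    = sym (lastDigit b (eval b cs) (c∷cs-digits 0))
coeff-digitAt b (c ∷ cs) c∷cs-digits (suc i) = begin
  coeff cs i                              ≡⟨ coeff-digitAt b cs (λ j → c∷cs-digits (suc j)) i ⟩
  digitAt b (eval b cs) i                 ≡⟨ cong (λ n → digitAt b n i) (shiftDigit b (eval b cs) (c∷cs-digits 0)) ⟨
  digitAt b (eval b (c ∷ cs) / b) i       ∎
  where open ≡-Reasoning

representation-unique : ∀ b .{{_ : NonZero b}} p q → DigitList b p → DigitList b q →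
                        eval b p ≡ eval b q → ∀ i → coeff p i ≡ coeff q i
representation-unique b p q p-digits q-digits p≡q i = begin
  coeff p i                ≡⟨ coeff-digitAt b p p-digits i ⟩
  digitAt b (eval b p) i   ≡⟨ cong (λ n → digitAt b n i) p≡q ⟩
  digitAt b (eval b q) i   ≡⟨ coeff-digitAt b q q-digits i ⟨
  coeff q i                ∎
  where open ≡-Reasoning

digitsFuel-digits : ∀ f n → DigitList 10 (digitsFuel f n)
digitsFuel-digits zero    n       i       = s≤s z≤n
digitsFuel-digits (suc f) zero    i       = s≤s z≤n
digitsFuel-digits (suc f) (suc n) zero    = m%n<n (suc n) 10
digitsFuel-digits (suc f) (suc n) (suc i) = digitsFuel-digits f (suc n / 10) i

coeff-addP : ∀ p q i → coeff (addP p q) i ≡ coeff p i + coeff q i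
coeff-addP []      q       i       = refl
coeff-addP (a ∷ p) []      i       = sym (+-identityʳ _)
coeff-addP (a ∷ p) (b ∷ q) zero    = refl
coeff-addP (a ∷ p) (b ∷ q) (suc i) = coeff-addP p q i

coeff-scale : ∀ a q i → coeff (scale a q) i ≡ a * coeff q i
coeff-scale a []      i       = sym (*-zeroʳ a)
coeff-scale a (b ∷ q) zero    = refl
coeff-scale a (b ∷ q) (suc i) = coeff-scale a q i

partialSum : List ℕ → ℕ → ℕ
partialSum q k = sum (take (suc k) q)

partialSum-zero : ∀ q → partialSum q 0 ≡ coeff q 0
partialSum-zero []      = refl
partialSum-zero (b ∷ q) = +-identityʳ b

partialSum-suc : ∀ q k → partialSum q (suc k) ≡ coeff q (suc k) + partialSum q k
partialSum-suc []      k       = refl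
partialSum-suc (b ∷ q) zero    = begin
  b + partialSum q 0    ≡⟨ cong (b +_) (partialSum-zero q) ⟩
  b + coeff q 0         ≡⟨ +-comm b (coeff q 0) ⟩
  coeff q 0 + b         ≡⟨ cong (coeff q 0 +_) (+-identityʳ b) ⟨
  coeff q 0 + (b + 0)   ∎
  where open ≡-Reasoning
partialSum-suc (b ∷ q) (suc k) = begin
  b + partialSum q (suc k)                 ≡⟨ cong (b +_) (partialSum-suc q k) ⟩
  b + (coeff q (suc k) + partialSum q k)   ≡⟨ +-assoc b _ _ ⟨
  b + coeff q (suc k) + partialSum q k     ≡⟨ cong (_+ partialSum q k) (+-comm b _) ⟩
  coeff q (suc k) + b + partialSum q k     ≡⟨ +-assoc (coeff q (suc k)) b _ ⟩
  coeff q (suc k) + (b + partialSum q k)   ∎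
  where open ≡-Reasoning

partialSum≤sum : ∀ q k → partialSum q k ≤ sum q
partialSum≤sum q k = begin
  sum (take (suc k) q)                              ≤⟨ m≤m+n _ _ ⟩
  sum (take (suc k) q) + sum (drop (suc k) q)       ≡⟨ sum-++ (take (suc k) q) (drop (suc k) q) ⟨
  sum (take (suc k) q ++ drop (suc k) q)            ≡⟨ cong sum (take++drop≡id (suc k) q) ⟩
  sum q                                             ∎
  where open ≤-Reasoning

coeff-mulP-bound : ∀ m p q → (∀ i → coeff p i ≤ m) → ∀ k → coeff (mulP p q) k ≤ m * partialSum q k
coeff-mulP-bound m []      q p≤m k       = z≤n
coeff-mulP-bound m (a ∷ p) q p≤m zero    = begin
  coeff (addP (scale a q) (0 ∷ mulP p q)) 0   ≡⟨ coeff-addP (scale a q) (0 ∷ mulP p q) 0 ⟩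
  coeff (scale a q) 0 + 0                     ≡⟨ +-identityʳ _ ⟩
  coeff (scale a q) 0                         ≡⟨ coeff-scale a q 0 ⟩
  a * coeff q 0                               ≤⟨ *-monoˡ-≤ (coeff q 0) (p≤m 0) ⟩
  m * coeff q 0                               ≡⟨ cong (m *_) (partialSum-zero q) ⟨
  m * partialSum q 0                          ∎
  where open ≤-Reasoning
coeff-mulP-bound m (a ∷ p) q p≤m (suc k) = begin
  coeff (addP (scale a q) (0 ∷ mulP p q)) (suc k)    ≡⟨ coeff-addP (scale a q) (0 ∷ mulP p q) (suc k) ⟩
  coeff (scale a q) (suc k) + coeff (mulP p q) k     ≡⟨ cong (_+ coeff (mulP p q) k) (coeff-scale a q (suc k)) ⟩
  a * coeff q (suc k) + coeff (mulP p q) k           ≤⟨ +-mono-≤ (*-monoˡ-≤ (coeff q (suc k)) (p≤m 0))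
                                                                 (coeff-mulP-bound m p q (λ j → p≤m (suc j)) k) ⟩
  m * coeff q (suc k) + m * partialSum q k           ≡⟨ *-distribˡ-+ m (coeff q (suc k)) (partialSum q k) ⟨
  m * (coeff q (suc k) + partialSum q k)             ≡⟨ cong (m *_) (partialSum-suc q k) ⟨
  m * partialSum q (suc k)                           ∎
  where open ≤-Reasoning

coeff≤maximum : ∀ p i → coeff p i ≤ foldr _⊔_ 0 p
coeff≤maximum []      i       = z≤n
coeff≤maximum (c ∷ p) zero    = m≤m⊔n c _
coeff≤maximum (c ∷ p) (suc i) = m≤n⇒m≤o⊔n c (coeff≤maximum p i)

coeff-mulP≤max*sum : ∀ p q k → coeff (mulP p q) k ≤ foldr _⊔_ 0 p * sum q
coeff-mulP≤max*sum p q k = ≤-trans (coeff-mulP-bound (foldr _⊔_ 0 p) p q (coeff≤maximum p) k)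
                                   (*-monoʳ-≤ (foldr _⊔_ 0 p) (partialSum≤sum q k))

proposition7 : (A B : ℕ) → .{{_ : NonZero A}} → .{{_ : NonZero B}} →
               maxDigit A * digitSum B ≤ 9 → PolynomialPair A B
proposition7 A B A∞B₁≤9 =
  representation-unique 10 (mulP (P A) (P B)) (P (A * B)) product-digits
                        (digitsFuel-digits (A * B) (A * B)) same-value
  where
  product-digits : DigitList 10 (mulP (P A) (P B))
  product-digits k = s≤s (≤-trans (coeff-mulP≤max*sum (P A) (P B) k) A∞B₁≤9)

  same-value : eval 10 (mulP (P A) (P B)) ≡ eval 10 (P (A * B))
  same-value = begin
    eval 10 (mulP (P A) (P B))        ≡⟨ eval-mulP 10 (P A) (P B) ⟩
    eval 10 (P A) * eval 10 (P B)     ≡⟨ cong₂ _*_ (eval-P A) (eval-P B) ⟩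
    A * B                             ≡⟨ eval-P (A * B) ⟨
    eval 10 (P (A * B))               ∎
    where open ≡-Reasoning
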